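{- Let $\tau$ be a chain preorder on a finite set $E$ and $\tau^\ast$ its dual. For all $k,\ell\in\mathbb{N}$, the number of $k$-element multichains in the poset of lattice points of $\ell\mathcal{Q}_\tau$ equals the number of $\ell$-element multichains in the poset of lattice points of $k\mathcal{Q}_{\tau^\ast}$. That is, the infinite matrix $\nabla_\tau$ is the transpose of $\nabla_{\tau^\ast}$.
   Context: A preorder on $E$ is a reflexive transitive relation $\le$; it is a chain if $a\le b$ or $b\le a$ for all $a,b\in E$. The dual $\tau^\ast$ reverses all relations. An order ideal of a preorder is a subset $\mathcal{I}$ with $b\in\mathcal{I},a\le b\Rightarrow a\in\mathcal{I}$. The preorder polytope $\mathcal{Q}_\tau\subset\mathbb{R}^E$ is defined by $x_e\ge0$ ($e\in E$) and $\sum_{e\in\mathcal{I}}x_e\le|\mathcal{I}|$ for every order ideal $\mathcal{I}$. The lattice points of $\ell\mathcal{Q}_\tau$ are ordered componentwise. A $k$-element multichain in a poset is a sequence $p_1\preceq\cdots\preceq p_k$. $\nabla_\tau(k,\ell)$ denotes the number of $k$-element multichains in the poset of lattice points of $\ell\mathcal{Q}_\tau$, for $k,\ell\in\mathbb{N}$. -}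

module Defs where

open import Data.Nat using (ℕ; zero; suc; _+_; _*_; _≤ᵇ_)
open import Data.Bool using (Bool; true; false; _∧_; _∨_; not; T?)
open import Data.Fin using (Fin)
open import Data.Fin.Subset using (Subset; ∣_∣)
open import Data.Vec using (Vec; []; _∷_; lookup)
open import Data.List using (List; []; _∷_; map; concatMap; filter; length; allFin; foldr)
open import Level using (0ℓ)
open import Relation.Nullary.Decidable using (⌊_⌋; does)
open import Relation.Binary using (Rel; Decidable)
open import Function using (flip)

-- A preorder τ on E is a relation
-- _≼_ : Rel (Fin n) 0ℓ that is decidable (E finite), together with the proofs
-- of reflexivity/transitivity (IsPreorder) and totality (chain) in the statement.

dual : ∀ {n} → Rel (Fin n) 0ℓ → Rel (Fin n) 0ℓ
dual R = flip R

allᵇ : ∀ {A : Set} → (A → Bool) → List A → Bool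
allᵇ p xs = foldr (λ a b → p a ∧ b) true xs

allSubsets : ∀ n → List (Subset n)
allSubsets zero = [] ∷ []
allSubsets (suc n) = concatMap (λ s → (true ∷ s) ∷ (false ∷ s) ∷ []) (allSubsets n)

isIdeal : ∀ {n} {_≼_ : Rel (Fin n) 0ℓ} → Decidable _≼_ → Subset n → Bool
isIdeal {n} _≼?_ I =
  allᵇ (λ a → allᵇ (λ b → not (lookup I b ∧ ⌊ a ≼? b ⌋) ∨ lookup I a) (allFin n)) (allFin n)

sumOver : ∀ {n} → Subset n → Vec ℕ n → ℕ
sumOver [] [] = 0
sumOver (true ∷ I) (x ∷ xs) = x + sumOver I xs
sumOver (false ∷ I) (x ∷ xs) = sumOver I xs

-- Boolean test: x (a lattice point, x_e ≥ 0 automatic in ℕ) lies in ℓ Q_τ,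
-- i.e. Σ_{e∈I} x_e ≤ ℓ·|I| for every order ideal I.
inDilatedQ : ∀ {n} {_≼_ : Rel (Fin n) 0ℓ} → Decidable _≼_ → ℕ → Vec ℕ n → Bool
inDilatedQ {n} dec ℓ x =
  allᵇ (λ I → not (isIdeal dec I) ∨ (sumOver I x ≤ᵇ ℓ * ∣ I ∣)) (allSubsets n)

box : ∀ n → ℕ → List (Vec ℕ n)
box zero B = [] ∷ []
box (suc n) B = concatMap (λ v → map (λ i → i ∷ v) (upto B)) (box n B)
  where
  upto : ℕ → List ℕ
  upto zero = zero ∷ []
  upto (suc m) = suc m ∷ upto m

-- Lattice points of ℓ Q_τ.  Every such x satisfies x_e ≤ ℓ·n (take I = E,
-- which is an order ideal), so they all lie in the box [0, ℓ·n]^n.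
latticePoints : ∀ {n} {_≼_ : Rel (Fin n) 0ℓ} → Decidable _≼_ → ℕ → List (Vec ℕ n)
latticePoints {n} dec ℓ = filter (λ x → T? (inDilatedQ dec ℓ x)) (box n (ℓ * n))

leqᵇ : ∀ {n} → Vec ℕ n → Vec ℕ n → Bool
leqᵇ [] [] = true
leqᵇ (x ∷ xs) (y ∷ ys) = (x ≤ᵇ y) ∧ leqᵇ xs ys

sequences : ∀ {A : Set} → List A → ℕ → List (List A)
sequences L zero = [] ∷ []
sequences L (suc k) = concatMap (λ p → map (p ∷_) (sequences L k)) L

isMultichain : ∀ {n} → List (Vec ℕ n) → Bool
isMultichain [] = true
isMultichain (p ∷ []) = true
isMultichain (p ∷ q ∷ ps) = leqᵇ p q ∧ isMultichain (q ∷ ps)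

∇ : ∀ {n} {_≼_ : Rel (Fin n) 0ℓ} → Decidable _≼_ → ℕ → ℕ → ℕ
∇ dec k ℓ = length (filter (λ ps → T? (isMultichain ps)) (sequences (latticePoints dec ℓ) k))

-- Relabel E so that τ is weakly increasing along 0, 1, …, n − 1; relabelling does not change ∇.
-- The order ideals of τ are then initial segments [0, N), and after reversing the labels those of τ*
-- are the segments [0, n − N).  A multichain p₁ ≤ ⋯ ≤ p_k in ℓQ_τ is recorded by the weakly
-- increasing word of length kn that lists, coordinate by coordinate, the entries of p₁, …, p_k
-- raised by the partial sums of p_k.  Such a word is a lattice path in a kn × ℓn box, and membership
-- in ℓQ_τ says that the path stays below the corner (kN, ℓN) for every ideal [0, N).  Conjugating
-- the path, i.e. transposing the box, sends these corners to (ℓ(n − N), k(n − N)), which is the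
-- same description of the ℓ-multichains in kQ_τ*.

module Submission where

open import Defs

open import Data.Bool using (Bool; true; false; T; T?; not; _∧_; _∨_; if_then_else_)
open import Data.Bool.Properties using (T-∧)
open import Data.Empty using (⊥; ⊥-elim)
open import Data.Fin as F using (Fin; zero; suc; toℕ; punchIn)
open import Data.Fin.Permutation as Perm using (Permutation′; _∘ₚ_; _⟨$⟩ʳ_; _⟨$⟩ˡ_; inverseʳ)
open import Data.Fin.Properties using (all?; opposite-prop; opposite-involutive; toℕ<n)
open import Data.Fin.Subset using (Subset; ⊤; ∣_∣)
open import Data.Fin.Subset.Properties using (∣⊤∣≡n)
open import Data.List
  using (List; []; _∷_; _++_; map; length; filter; take; drop; replicate; zipWith; concatMap;
         cartesianProductWith; downFrom; allFin)
open import Data.List.Membership.Propositional using (_∈_)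
open import Data.List.Membership.Propositional.Properties
  using (∈-map⁺; ∈-map⁻; ∈-filter⁺; ∈-filter⁻; ∈-allFin; ∈-downFrom⁺; ∈-downFrom⁻; ∈-concatMap⁺;
         ∈-cartesianProductWith⁺; ∈-cartesianProductWith⁻)
open import Data.List.Membership.Propositional.Properties.WithK using (unique∧set⇒bag)
open import Data.List.Properties
  using (∷-injective; length-map; length-++; length-take; length-drop; length-replicate; length-zipWith;
         length-downFrom; length-filter; map-∘; map-id-local; map-cong-local; take-all; take-map;
         take++drop≡id; filter-all; filter-accept; filter-none; filter-reject; filter-++; filter-≐)
open import Data.List.Relation.Binary.BagAndSetEquality using (set; _∼[_]_; ∼bag⇒↭)
open import Data.List.Relation.Binary.Permutation.Propositional.Properties using (↭-length)
open import Data.List.Relation.Binary.Sublist.Propositional using (⊆-refl)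
import Data.List.Relation.Binary.Sublist.Propositional.Properties as Sublist
open import Data.List.Relation.Unary.All as All using (All; []; _∷_)
import Data.List.Relation.Unary.All.Properties as All
open import Data.List.Relation.Unary.AllPairs as AllPairs using (AllPairs; []; _∷_; allPairs?)
import Data.List.Relation.Unary.AllPairs.Properties as AllPairs
open import Data.List.Relation.Unary.Any as Any using (here; there)
open import Data.List.Relation.Unary.Linked using (Linked; []; [-]; _∷_)
open import Data.List.Relation.Unary.Linked.Properties using (Linked⇒AllPairs; AllPairs⇒Linked)
open import Data.List.Relation.Unary.Unique.Propositional using (Unique)
import Data.List.Relation.Unary.Unique.Propositional.Properties as Unique
open import Data.Nat
  using (ℕ; zero; suc; _+_; _*_; _∸_; _⊓_; _≤_; _<_; _≤ᵇ_; _≤?_; _<?_; z≤n; s≤s; z<s; s<s)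
open import Data.Nat.Properties
  using (≤-refl; ≤-reflexive; ≤-trans; ≤-antisym; ≤-pred; <-trans; ≤-<-trans; <-≤-trans; <⇒≤; ≮⇒≥;
         <⇒≱; ≤⇒≯; n<1+n; m<n⇒m<1+n; m≤m+n; m≤n+m; ≤ᵇ⇒≤; ≤⇒≤ᵇ; suc-injective; +-identityʳ;
         +-mono-≤; +-monoʳ-≤; +-cancelˡ-≤; *-zeroʳ; *-suc; *-monoʳ-≤; *-distribˡ-∸; m+n∸m≡n;
         m+[n∸m]≡n; m∸n≤m; m∸[m∸n]≡n; ∸-monoˡ-≤; ∸-monoʳ-≤; ∸-monoʳ-<; ⊓-idem; m≤n⇒m⊓n≡m;
         allUpTo?; +-0-commutativeMonoid; module ≤-Reasoning)
open import Data.Product using (_×_; _,_; proj₁; proj₂; ∃)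
open import Data.Sum using (inj₁; inj₂; [_,_]′)
open import Data.Unit using (tt)
open import Data.Vec as V using (Vec; []; _∷_)
open import Data.Vec.Properties using (lookup-replicate; lookup∘tabulate; tabulate∘lookup; tabulate-cong)
open import Data.Vec.Relation.Binary.Pointwise.Inductive as Pointwise using (Pointwise; []; _∷_)
import Data.Vec.Relation.Unary.All as VAll
open import Function using (_∘_; _$_; id; const; flip; _on_; case_of_; _⇔_; mk⇔; Equivalence)
open import Level using (0ℓ)
open import Relation.Binary using (Rel; Decidable; IsPreorder; Reflexive; Transitive; Total; _⇒_)
open import Relation.Binary.PropositionalEquality
  using (_≡_; refl; sym; trans; cong; cong₂; subst; subst₂; module ≡-Reasoning)
open import Relation.Nullary using (¬_; Dec; yes; no; contradiction)
open import Relation.Nullary.Decidable using (does; map′; _×-dec_; _→-dec_; ⌊_⌋; toWitness; fromWitness)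
import Relation.Unary as U
open import Algebra.Properties.CommutativeMonoid.Sum +-0-commutativeMonoid using (sum; sum-cong-≗; sum-permute)

open Equivalence using (to; from)
open Sublist using (length-mono-≤)

module _ {A B : Set} {xs : List A} {ys : List B} where

  length-≡-by-inverses : Unique xs → Unique ys → (f : A → B) (g : B → A)
    → (∀ {x} → x ∈ xs → f x ∈ ys × g (f x) ≡ x)
    → (∀ {y} → y ∈ ys → g y ∈ xs × f (g y) ≡ y)
    → length xs ≡ length ys
  length-≡-by-inverses xs! ys! f g f-into g-into = begin
    length xs          ≡⟨ length-map f xs ⟨
    length (map f xs)  ≡⟨ ↭-length (∼bag⇒↭ (unique∧set⇒bag fxs! ys! fxs≈ys)) ⟩
    length ys          ∎
    where
    open ≡-Reasoning
    gfxs≡xs : map g (map f xs) ≡ xs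
    gfxs≡xs = trans (sym (map-∘ xs)) (map-id-local (All.tabulate (proj₂ ∘ f-into)))
    fxs! : Unique (map f xs)
    fxs! = Unique.map⁻ (subst Unique (sym gfxs≡xs) xs!)
    fxs≈ys : map f xs ∼[ set ] ys
    fxs≈ys = mk⇔ into onto
      where
      into : ∀ {y} → y ∈ map f xs → y ∈ ys
      into y∈ with _ , x∈ , refl ← ∈-map⁻ f y∈ = proj₁ (f-into x∈)
      onto : ∀ {y} → y ∈ ys → y ∈ map f xs
      onto y∈ with g-into y∈
      ... | gy∈ , fgy≡y = subst (_∈ map f xs) fgy≡y (∈-map⁺ f gy∈)

concatMap-map : ∀ {A B C : Set} (f : A → B → C) xs ys →
                concatMap (λ x → map (f x) ys) xs ≡ cartesianProductWith f xs ys
concatMap-map f []       ys = refl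
concatMap-map f (x ∷ xs) ys = cong (map (f x) ys ++_) (concatMap-map f xs ys)

lastOr : ∀ {A : Set} → A → List A → A
lastOr d []       = d
lastOr d (x ∷ xs) = lastOr x xs

module _ {A : Set} where

  lastOr-map : ∀ {B : Set} (f : A → B) d xs → lastOr (f d) (map f xs) ≡ f (lastOr d xs)
  lastOr-map f d []       = refl
  lastOr-map f d (x ∷ xs) = lastOr-map f x xs

  lastOr-++ : ∀ (d : A) xs ys → lastOr d (xs ++ ys) ≡ lastOr (lastOr d xs) ys
  lastOr-++ d []       ys = refl
  lastOr-++ d (x ∷ xs) ys = lastOr-++ x xs ys

  lastOr-All : ∀ {P : U.Pred A 0ℓ} {d xs} → P d → All P xs → P (lastOr d xs)
  lastOr-All pd []         = pd
  lastOr-All pd (px ∷ pxs) = lastOr-All px pxs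

  ≼-lastOr : ∀ {R : Rel A 0ℓ} → Reflexive R → ∀ {d xs} → AllPairs R xs → All (λ x → R x (lastOr d xs)) xs
  ≼-lastOr R-refl {xs = []}     []              = []
  ≼-lastOr R-refl {xs = x ∷ xs} (x≼xs ∷ sorted) =
    All.lookup (R-refl ∷ x≼xs) (lastOr-∈ x xs) ∷ ≼-lastOr R-refl sorted
    where
    lastOr-∈ : ∀ d xs → lastOr d xs ∈ d ∷ xs
    lastOr-∈ d []       = here refl
    lastOr-∈ d (x ∷ xs) = there (lastOr-∈ x xs)

  take-++ : ∀ (xs ys : List A) m → take (length xs + m) (xs ++ ys) ≡ xs ++ take m ys
  take-++ []       ys m = refl
  take-++ (x ∷ xs) ys m = cong (x ∷_) (take-++ xs ys m)

  take-length-++ : ∀ (xs ys : List A) → take (length xs) (xs ++ ys) ≡ xs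
  take-length-++ []       ys = refl
  take-length-++ (x ∷ xs) ys = cong (x ∷_) (take-length-++ xs ys)

  drop-length-++ : ∀ (xs ys : List A) → drop (length xs) (xs ++ ys) ≡ ys
  drop-length-++ []       ys = refl
  drop-length-++ (x ∷ xs) ys = drop-length-++ xs ys

  AllPairs-++⁻ : ∀ {R : Rel A 0ℓ} xs {ys} → AllPairs R (xs ++ ys) →
                 AllPairs R xs × AllPairs R ys × All (λ x → All (R x) ys) xs
  AllPairs-++⁻ []       sorted              = [] , sorted , []
  AllPairs-++⁻ (x ∷ xs) (x≼xs++ys ∷ sorted) =
    let xs-sorted , ys-sorted , xs≼ys = AllPairs-++⁻ xs sorted
    in  All.++⁻ˡ xs x≼xs++ys ∷ xs-sorted , ys-sorted , All.++⁻ʳ xs x≼xs++ys ∷ xs≼ys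

lastOr-shift : ∀ a xs → lastOr a (map (a +_) xs) ≡ a + lastOr 0 xs
lastOr-shift a xs =
  trans (cong (λ d → lastOr d (map (a +_) xs)) (sym (+-identityʳ a))) (lastOr-map (a +_) 0 xs)

sorted-≤-lastOr : ∀ {xs c} → AllPairs _≤_ xs → lastOr 0 xs ≤ c → All (_≤ c) xs
sorted-≤-lastOr sorted last≤c = All.map (λ x≤last → ≤-trans x≤last last≤c) (≼-lastOr ≤-refl sorted)

length-take-drop : ∀ {A : Set} k n (h : List A) → length h ≡ k * suc n →
                   length (take k h) ≡ k × length (drop k h) ≡ k * n
length-take-drop k n h |h|≡k[1+n] =
  trans (length-take k h) (m≤n⇒m⊓n≡m (subst (k ≤_) (sym |h|≡k+kn) (m≤m+n k (k * n)))) ,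
  trans (length-drop k h) (trans (cong (_∸ k) |h|≡k+kn) (m+n∸m≡n k (k * n)))
  where
  |h|≡k+kn : length h ≡ k + k * n
  |h|≡k+kn = trans |h|≡k[1+n] (*-suc k n)

length-filter-map : ∀ {A B : Set} {P : U.Pred B 0ℓ} (P? : U.Decidable P) (f : A → B) xs →
                    length (filter P? (map f xs)) ≡ length (filter (P? ∘ f) xs)
length-filter-map P? f []       = refl
length-filter-map P? f (x ∷ xs) with does (P? (f x))
... | true  = cong suc (length-filter-map P? f xs)
... | false = length-filter-map P? f xs

T-allᵇ : ∀ {A : Set} (p : A → Bool) xs → T (allᵇ p xs) ⇔ All (T ∘ p) xs
T-allᵇ p []       = mk⇔ (const []) (const tt)
T-allᵇ p (x ∷ xs) = mk⇔
  (λ t → let px , pxs = to T-∧ t in px ∷ to (T-allᵇ p xs) pxs)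
  (λ { (px ∷ pxs) → from T-∧ (px , from (T-allᵇ p xs) pxs) })

T-allᵇ-complete : ∀ {A : Set} (p : A → Bool) {xs} → (∀ x → x ∈ xs) → T (allᵇ p xs) ⇔ (∀ x → T (p x))
T-allᵇ-complete p {xs} complete = mk⇔
  (λ t x → All.lookup (to (T-allᵇ p xs) t) (complete x))
  (λ all-p → from (T-allᵇ p xs) (All.tabulate λ {x} _ → all-p x))

T-not-∨ : ∀ {x y} → T (not x ∨ y) ⇔ (T x → T y)
T-not-∨ {true}  = mk⇔ const (_$ tt)
T-not-∨ {false} = mk⇔ (λ _ ()) (const tt)

T-not-∧-∨ : ∀ {x y z} → T (not (x ∧ y) ∨ z) ⇔ (T x → T y → T z)
T-not-∧-∨ {true}  = mk⇔ (λ t _ → to T-not-∨ t) (λ f → from T-not-∨ (f tt))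
T-not-∧-∨ {false} = mk⇔ (λ _ ()) (const tt)

module _ {A : Set} (L : List A) where

  sequences-suc : ∀ k → sequences L (suc k) ≡ cartesianProductWith _∷_ L (sequences L k)
  sequences-suc k = concatMap-map _∷_ L (sequences L k)

  ∈-sequences : ∀ k {ps} → ps ∈ sequences L k ⇔ (length ps ≡ k × All (_∈ L) ps)
  ∈-sequences k = mk⇔ (into k) (onto k)
    where
    into : ∀ k {ps} → ps ∈ sequences L k → length ps ≡ k × All (_∈ L) ps
    into zero    (here refl) = refl , []
    into (suc k) ps∈
      with p , qs , p∈ , qs∈ , refl ← ∈-cartesianProductWith⁻ _∷_ L _ (subst (_ ∈_) (sequences-suc k) ps∈)
      with |qs|≡k , qs⊆L ← into k qs∈
      = cong suc |qs|≡k , p∈ ∷ qs⊆L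
    onto : ∀ k {ps} → length ps ≡ k × All (_∈ L) ps → ps ∈ sequences L k
    onto zero    {[]}     _                 = here refl
    onto (suc k) {p ∷ ps} (refl , p∈ ∷ ps⊆L) =
      subst (_ ∈_) (sym (sequences-suc k)) (∈-cartesianProductWith⁺ _∷_ p∈ (onto k (refl , ps⊆L)))

  sequences-unique : Unique L → ∀ k → Unique (sequences L k)
  sequences-unique L! zero    = [] ∷ []
  sequences-unique L! (suc k) = subst Unique (sym (sequences-suc k))
    (Unique.cartesianProductWith⁺ _∷_ ∷-injective L! (sequences-unique L! k))

-- `box` draws its digits from a list local to its definition; `box 1` exposes that list.
box-digits : ∀ B → map V.head (box 1 B) ≡ downFrom (suc B)
box-digits zero    = refl
box-digits (suc B) = cong (suc B ∷_) (box-digits B)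

box-suc : ∀ n B → box (suc n) B ≡ cartesianProductWith (flip _∷_) (box n B) (map V.head (box 1 B))
box-suc n B = trans (concatMap-map (flip _∷_) (box n B) _)
                    (cong (cartesianProductWith (flip _∷_) (box n B)) (sym (digits _)))
  where
  digits : ∀ (ds : List ℕ) → map V.head (concatMap (λ v → map (λ d → d ∷ v) ds) ([] ∷ [])) ≡ ds
  digits []       = refl
  digits (d ∷ ds) = cong (d ∷_) (digits ds)

∈-box⁺ : ∀ {n} B {v : Vec ℕ n} → VAll.All (_≤ B) v → v ∈ box n B
∈-box⁺ B {[]}    VAll.[]          = here refl
∈-box⁺ B {x ∷ v} (x≤B VAll.∷ v≤B) = subst (_ ∈_) (sym (box-suc _ B))
  (∈-cartesianProductWith⁺ (flip _∷_) (∈-box⁺ B v≤B)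
    (subst (x ∈_) (sym (box-digits B)) (∈-downFrom⁺ (s≤s x≤B))))

box-unique : ∀ n B → Unique (box n B)
box-unique zero    B = [] ∷ []
box-unique (suc n) B = subst Unique (sym (box-suc n B))
  (Unique.cartesianProductWith⁺ (flip _∷_) (λ { refl → refl , refl }) (box-unique n B)
    (subst Unique (sym (box-digits B)) (Unique.downFrom⁺ (suc B))))

∈-allSubsets : ∀ {n} (I : Subset n) → I ∈ allSubsets n
∈-allSubsets []      = here refl
∈-allSubsets (b ∷ I) =
  ∈-concatMap⁺ (λ s → (true ∷ s) ∷ (false ∷ s) ∷ []) (Any.map (λ { refl → here-or-there b }) (∈-allSubsets I))
  where
  here-or-there : ∀ b → b ∷ I ∈ (true ∷ I) ∷ (false ∷ I) ∷ []
  here-or-there true  = here refl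
  here-or-there false = there (here refl)

module _ {n : ℕ} where

  IsOrderIdeal : Rel (Fin n) 0ℓ → Subset n → Set
  IsOrderIdeal _≼_ I = ∀ a b → T (V.lookup I b) → a ≼ b → T (V.lookup I a)

  InPolytope : Rel (Fin n) 0ℓ → ℕ → Vec ℕ n → Set
  InPolytope _≼_ ℓ x = ∀ I → IsOrderIdeal _≼_ I → sumOver I x ≤ ℓ * ∣ I ∣

  _≤ᵥ_ : Rel (Vec ℕ n) 0ℓ
  _≤ᵥ_ = Pointwise _≤_

  ⊤-isOrderIdeal : ∀ {_≼_} → IsOrderIdeal _≼_ ⊤
  ⊤-isOrderIdeal a _ _ _ = subst T (sym (lookup-replicate a true)) tt

entries≤sumOver-⊤ : ∀ {n} (x : Vec ℕ n) → VAll.All (_≤ sumOver ⊤ x) x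
entries≤sumOver-⊤ []      = VAll.[]
entries≤sumOver-⊤ (x ∷ xs) =
  m≤m+n x _ VAll.∷ VAll.map (λ le → ≤-trans le (m≤n+m _ x)) (entries≤sumOver-⊤ xs)

T-leqᵇ : ∀ {n} {u v : Vec ℕ n} → T (leqᵇ u v) ⇔ u ≤ᵥ v
T-leqᵇ {u = []}    {[]}    = mk⇔ (const []) (const tt)
T-leqᵇ {u = x ∷ u} {y ∷ v} = mk⇔
  (λ t → let x≤y , u≤v = to T-∧ t in ≤ᵇ⇒≤ x y x≤y ∷ to T-leqᵇ u≤v)
  (λ { (x≤y ∷ u≤v) → from T-∧ (≤⇒≤ᵇ x≤y , from T-leqᵇ u≤v) })

T-isMultichain : ∀ {n} {ps : List (Vec ℕ n)} → T (isMultichain ps) ⇔ Linked _≤ᵥ_ ps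
T-isMultichain = mk⇔ into onto
  where
  into : ∀ {n} {ps : List (Vec ℕ n)} → T (isMultichain ps) → Linked _≤ᵥ_ ps
  into {ps = []}         _ = []
  into {ps = p ∷ []}     _ = [-]
  into {ps = p ∷ q ∷ ps} t = let p≤q , chain = to T-∧ t in to T-leqᵇ p≤q ∷ into chain
  onto : ∀ {n} {ps : List (Vec ℕ n)} → Linked _≤ᵥ_ ps → T (isMultichain ps)
  onto []            = tt
  onto [-]           = tt
  onto (p≤q ∷ chain) = from T-∧ (from T-leqᵇ p≤q , onto chain)

record IsMultichain {n} (_≼_ : Rel (Fin n) 0ℓ) (k ℓ : ℕ) (ps : List (Vec ℕ n)) : Set where
  field
    length≡    : length ps ≡ k
    chain      : AllPairs _≤ᵥ_ ps
    inPolytope : All (InPolytope _≼_ ℓ) ps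

module _ {n : ℕ} {_≼_ : Rel (Fin n) 0ℓ} (_≼?_ : Decidable _≼_) where

  T-isIdeal : ∀ I → T (isIdeal _≼?_ I) ⇔ IsOrderIdeal _≼_ I
  T-isIdeal I = mk⇔
    (λ t a b b∈I a≼b → to T-not-∧-∨ (to (T-allᵇ-complete (edge a) ∈-allFin)
      (to (T-allᵇ-complete (λ a → allᵇ (edge a) (allFin n)) ∈-allFin) t a) b) b∈I (fromWitness a≼b))
    (λ ideal → from (T-allᵇ-complete _ ∈-allFin) λ a → from (T-allᵇ-complete (edge a) ∈-allFin) λ b →
      from T-not-∧-∨ (λ b∈I a≼b → ideal a b b∈I (toWitness a≼b)))
    where
    edge : Fin n → Fin n → Bool
    edge a b = not (V.lookup I b ∧ ⌊ a ≼? b ⌋) ∨ V.lookup I a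

  T-inDilatedQ : ∀ ℓ x → T (inDilatedQ _≼?_ ℓ x) ⇔ InPolytope _≼_ ℓ x
  T-inDilatedQ ℓ x = mk⇔
    (λ t I ideal → ≤ᵇ⇒≤ _ _ (to T-not-∨ (to (T-allᵇ-complete constraint ∈-allSubsets) t I)
                                         (from (T-isIdeal I) ideal)))
    (λ x∈Q → from (T-allᵇ-complete constraint ∈-allSubsets) λ I →
      from T-not-∨ (λ t → ≤⇒≤ᵇ (x∈Q I (to (T-isIdeal I) t))))
    where
    constraint : Subset n → Bool
    constraint I = not (isIdeal _≼?_ I) ∨ (sumOver I x ≤ᵇ ℓ * ∣ I ∣)

  ∈-latticePoints : ∀ ℓ {x} → x ∈ latticePoints _≼?_ ℓ ⇔ InPolytope _≼_ ℓ x
  ∈-latticePoints ℓ {x} = mk⇔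
    (λ x∈ → to (T-inDilatedQ ℓ x) (proj₂ (∈-filter⁻ inQ? {xs = box n (ℓ * n)} x∈)))
    (λ x∈Q → ∈-filter⁺ inQ?
      (∈-box⁺ (ℓ * n) (VAll.map (λ le → ≤-trans le (total-bound x∈Q)) (entries≤sumOver-⊤ x)))
      (from (T-inDilatedQ ℓ x) x∈Q))
    where
    inQ? : U.Decidable (λ y → T (inDilatedQ _≼?_ ℓ y))
    inQ? y = T? (inDilatedQ _≼?_ ℓ y)
    total-bound : InPolytope _≼_ ℓ x → sumOver ⊤ x ≤ ℓ * n
    total-bound x∈Q = subst (λ m → sumOver ⊤ x ≤ ℓ * m) (∣⊤∣≡n n) (x∈Q ⊤ ⊤-isOrderIdeal)

  latticePoints-unique : ∀ ℓ → Unique (latticePoints _≼?_ ℓ)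
  latticePoints-unique ℓ = Unique.filter⁺ _ (box-unique n (ℓ * n))

  -- `∇ _≼?_ k ℓ` is by definition `length (multichains k ℓ)`.
  multichains : ℕ → ℕ → List (List (Vec ℕ n))
  multichains k ℓ = filter (λ ps → T? (isMultichain ps)) (sequences (latticePoints _≼?_ ℓ) k)

  multichains-unique : ∀ k ℓ → Unique (multichains k ℓ)
  multichains-unique k ℓ = Unique.filter⁺ _ (sequences-unique _ (latticePoints-unique ℓ) k)

  ∈-multichains : ∀ k ℓ {ps} → ps ∈ multichains k ℓ ⇔ IsMultichain _≼_ k ℓ ps
  ∈-multichains k ℓ = mk⇔
    (λ ps∈ → let ps∈seq , t = ∈-filter⁻ chain? ps∈
                 |ps|≡k , ps⊆ = to (∈-sequences _ k) ps∈seq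
             in record { length≡ = |ps|≡k
                       ; chain = Linked⇒AllPairs (Pointwise.trans ≤-trans) (to T-isMultichain t)
                       ; inPolytope = All.map (to (∈-latticePoints ℓ)) ps⊆ })
    (λ mc → let open IsMultichain mc in
      ∈-filter⁺ chain? (from (∈-sequences _ k) (length≡ , All.map (from (∈-latticePoints ℓ)) inPolytope))
                  (from T-isMultichain (AllPairs⇒Linked chain)))
    where
    chain? : U.Decidable (λ (ps : List (Vec ℕ n)) → T (isMultichain ps))
    chain? ps = T? (isMultichain ps)

-- Relabelling the ground set

relabel : ∀ {A : Set} {n} → Permutation′ n → Vec A n → Vec A n
relabel π v = V.tabulate (λ i → V.lookup v (π ⟨$⟩ʳ i))

lookup-relabel : ∀ {A : Set} {n} (π : Permutation′ n) (v : Vec A n) i →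
                 V.lookup (relabel π v) i ≡ V.lookup v (π ⟨$⟩ʳ i)
lookup-relabel π v = lookup∘tabulate _

relabel-flip : ∀ {A : Set} {n} (π : Permutation′ n) (v : Vec A n) → relabel (Perm.flip π) (relabel π v) ≡ v
relabel-flip π v = trans
  (tabulate-cong λ i → trans (lookup-relabel π v (π ⟨$⟩ˡ i)) (cong (V.lookup v) (inverseʳ π)))
  (tabulate∘lookup v)

module _ {n : ℕ} (π : Permutation′ n) where

  relabel-replicate : ∀ {A : Set} (a : A) → relabel π (V.replicate n a) ≡ V.replicate n a
  relabel-replicate a = trans
    (tabulate-cong λ i → trans (lookup-replicate (π ⟨$⟩ʳ i) a) (sym (lookup-replicate i a)))
    (tabulate∘lookup _)

  relabel-mono : ∀ {u v : Vec ℕ n} → u ≤ᵥ v → relabel π u ≤ᵥ relabel π v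
  relabel-mono u≤v = Pointwise.tabulate⁺ (λ i → Pointwise.lookup u≤v (π ⟨$⟩ʳ i))

  sumOver-relabel : ∀ I x → sumOver (relabel π I) (relabel π x) ≡ sumOver I x
  sumOver-relabel I x = begin
    sumOver (relabel π I) (relabel π x)       ≡⟨ sumOver≡sum (relabel π I) (relabel π x) ⟩
    sum (select (relabel π I) (relabel π x))  ≡⟨ sum-cong-≗ (λ i → cong₂ (λ b y → if b then y else 0)
                                                   (lookup-relabel π I i) (lookup-relabel π x i)) ⟩
    sum (select I x ∘ (π ⟨$⟩ʳ_))              ≡⟨ sum-permute (select I x) π ⟨
    sum (select I x)                          ≡⟨ sumOver≡sum I x ⟨
    sumOver I x                               ∎
    where
    open ≡-Reasoning
    select : ∀ {m} → Subset m → Vec ℕ m → Fin m → ℕ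
    select I x i = if V.lookup I i then V.lookup x i else 0
    sumOver≡sum : ∀ {m} (I : Subset m) x → sumOver I x ≡ sum (select I x)
    sumOver≡sum []          []       = refl
    sumOver≡sum (true ∷ I)  (x ∷ xs) = cong (x +_) (sumOver≡sum I xs)
    sumOver≡sum (false ∷ I) (x ∷ xs) = sumOver≡sum I xs

  ∣relabel∣ : ∀ I → ∣ relabel π I ∣ ≡ ∣ I ∣
  ∣relabel∣ I = begin
    ∣ relabel π I ∣                                     ≡⟨ ∣∣≡sumOver-ones (relabel π I) ⟩
    sumOver (relabel π I) ones                          ≡⟨ cong (sumOver (relabel π I)) (relabel-replicate 1) ⟨
    sumOver (relabel π I) (relabel π ones)              ≡⟨ sumOver-relabel I ones ⟩
    sumOver I ones                                      ≡⟨ ∣∣≡sumOver-ones I ⟨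
    ∣ I ∣                                               ∎
    where
    open ≡-Reasoning
    ones = V.replicate n 1
    ∣∣≡sumOver-ones : ∀ {m} (I : Subset m) → ∣ I ∣ ≡ sumOver I (V.replicate m 1)
    ∣∣≡sumOver-ones []          = refl
    ∣∣≡sumOver-ones (true ∷ I)  = cong suc (∣∣≡sumOver-ones I)
    ∣∣≡sumOver-ones (false ∷ I) = ∣∣≡sumOver-ones I

  module _ {R R′ : Rel (Fin n) 0ℓ} (R⇒R′ : ∀ {a b} → R (π ⟨$⟩ʳ a) (π ⟨$⟩ʳ b) → R′ a b) where

    isOrderIdeal-relabel : ∀ {J} → IsOrderIdeal R′ J → IsOrderIdeal R (relabel (Perm.flip π) J)
    isOrderIdeal-relabel {J} J-ideal a b b∈ aRb =
      subst T (sym (lookup-relabel (Perm.flip π) J a))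
        (J-ideal _ _ (subst T (lookup-relabel (Perm.flip π) J b) b∈)
          (R⇒R′ (subst₂ R (sym (inverseʳ π)) (sym (inverseʳ π)) aRb)))

    inPolytope-relabel : ∀ {ℓ x} → InPolytope R ℓ x → InPolytope R′ ℓ (relabel π x)
    inPolytope-relabel {ℓ} {x} x∈Q J J-ideal = begin
      sumOver J (relabel π x)              ≡⟨ cong (λ K → sumOver K (relabel π x)) J≡πI ⟩
      sumOver (relabel π I) (relabel π x)  ≡⟨ sumOver-relabel I x ⟩
      sumOver I x                          ≤⟨ x∈Q I (isOrderIdeal-relabel {J} J-ideal) ⟩
      ℓ * ∣ I ∣                            ≡⟨ cong (ℓ *_) (trans (sym (∣relabel∣ I)) (cong ∣_∣ (sym J≡πI))) ⟩
      ℓ * ∣ J ∣                            ∎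
      where
      open ≤-Reasoning
      I = relabel (Perm.flip π) J
      J≡πI : J ≡ relabel π I
      J≡πI = sym (relabel-flip (Perm.flip π) J)

    isMultichain-relabel : ∀ {k ℓ ps} → IsMultichain R k ℓ ps → IsMultichain R′ k ℓ (map (relabel π) ps)
    isMultichain-relabel {ℓ = ℓ} {ps} mc = record
      { length≡    = trans (length-map _ ps) length≡
      ; chain      = AllPairs.map⁺ (AllPairs.map relabel-mono chain)
      ; inPolytope = All.map⁺ (All.map (inPolytope-relabel {ℓ}) inPolytope)
      }
      where open IsMultichain mc

∇-relabel : ∀ {n} {_≼_ : Rel (Fin n) 0ℓ} (_≼?_ : Decidable _≼_) (π : Permutation′ n) k ℓ →
            ∇ _≼?_ k ℓ ≡ ∇ {n} {_≼_ on (π ⟨$⟩ʳ_)} (λ a b → (π ⟨$⟩ʳ a) ≼? (π ⟨$⟩ʳ b)) k ℓ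
∇-relabel {n} {_≼_} _≼?_ π k ℓ =
  length-≡-by-inverses (multichains-unique _≼?_ k ℓ) (multichains-unique _≼π?_ k ℓ)
    (map (relabel π)) (map (relabel (Perm.flip π)))
    (λ ps∈ → from (∈-multichains _≼π?_ k ℓ) (isMultichain-relabel π id (to (∈-multichains _≼?_ k ℓ) ps∈))
           , map-relabel-flip π _)
    (λ ps∈ → from (∈-multichains _≼?_ k ℓ)
               (isMultichain-relabel (Perm.flip π) (subst₂ _≼_ (inverseʳ π) (inverseʳ π))
                 (to (∈-multichains _≼π?_ k ℓ) ps∈))
           , map-relabel-flip (Perm.flip π) _)
  where
  _≼π?_ : Decidable (_≼_ on (π ⟨$⟩ʳ_))
  a ≼π? b = (π ⟨$⟩ʳ a) ≼? (π ⟨$⟩ʳ b)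
  map-relabel-flip : ∀ ρ (ps : List (Vec ℕ n)) → map (relabel (Perm.flip ρ)) (map (relabel ρ) ps) ≡ ps
  map-relabel-flip ρ ps = trans (sym (map-∘ ps)) (map-id-local (All.tabulate λ {p} _ → relabel-flip ρ p))

least : ∀ {n} {R : Rel (Fin (suc n)) 0ℓ} → Transitive R → Total R → ∃ λ m → ∀ a → R m a
least {zero}      tr tot = zero , λ { zero → [ id , id ]′ (tot zero zero) }
least {suc n} {R} tr tot with least {R = R on suc} tr (λ a b → tot (suc a) (suc b))
... | m , m≼ with tot zero (suc m)
...   | inj₁ 0≼m = zero  , λ { zero → [ id , id ]′ (tot zero zero) ; (suc a) → tr 0≼m (m≼ a) }
...   | inj₂ m≼0 = suc m , λ { zero → m≼0 ; (suc a) → m≼ a }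

sorting-permutation : ∀ {n} {R : Rel (Fin n) 0ℓ} → Transitive R → Total R →
                      ∃ λ (σ : Permutation′ n) → F._≤_ ⇒ (R on (σ ⟨$⟩ʳ_))
sorting-permutation {zero}      tr tot = Perm.id , λ { {()} }
sorting-permutation {suc n} {R} tr tot
  with m , m≼ ← least tr tot
  with σ , sorted ← sorting-permutation {R = R on punchIn m} tr (λ a b → tot (punchIn m a) (punchIn m b))
  = Perm.insert zero m σ , λ { {zero} _ → m≼ _ ; {suc i} {suc j} (s≤s i≤j) → sorted i≤j }

-- Order ideals of a sorted chain

prefix : ∀ n → ℕ → Subset n
prefix zero    N       = []
prefix (suc n) zero    = false ∷ prefix n zero
prefix (suc n) (suc N) = true ∷ prefix n N

∈-prefix : ∀ {n N} {i : Fin n} → T (V.lookup (prefix n N) i) ⇔ toℕ i < N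
∈-prefix = mk⇔ into onto
  where
  into : ∀ {n N} {i : Fin n} → T (V.lookup (prefix n N) i) → toℕ i < N
  into {suc n} {zero}  {zero}  ()
  into {suc n} {zero}  {suc i} t with () ← into {n} {zero} {i} t
  into {suc n} {suc N} {zero}  _ = z<s
  into {suc n} {suc N} {suc i} t = s<s (into t)
  onto : ∀ {n N} {i : Fin n} → toℕ i < N → T (V.lookup (prefix n N) i)
  onto {suc n} {suc N} {zero}  _         = tt
  onto {suc n} {suc N} {suc i} (s<s i<N) = onto i<N

∣prefix∣ : ∀ {n N} → N ≤ n → ∣ prefix n N ∣ ≡ N
∣prefix∣ {zero}  z≤n       = refl
∣prefix∣ {suc n} z≤n       = ∣prefix∣ {n} z≤n
∣prefix∣ {suc n} (s≤s N≤n) = cong suc (∣prefix∣ N≤n)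

downClosed⇒prefix : ∀ {n} (I : Subset n) → (∀ {a b} → a F.≤ b → T (V.lookup I b) → T (V.lookup I a)) →
                    ∃ λ N → N ≤ n × I ≡ prefix n N
downClosed⇒prefix []          _      = 0 , z≤n , refl
downClosed⇒prefix (true ∷ I)  closed with downClosed⇒prefix I (λ a≤b → closed (s≤s a≤b))
... | N , N≤n , refl = suc N , s≤s N≤n , refl
downClosed⇒prefix (false ∷ I) closed =
  0 , z≤n , cong (false ∷_) (empty I (λ {b} b∈ → closed {zero} {suc b} z≤n b∈))
  where
  empty : ∀ {m} (I : Subset m) → (∀ {b} → T (V.lookup I b) → ⊥) → I ≡ prefix m 0
  empty []          _  = refl
  empty (true ∷ I)  ∉I = ⊥-elim (∉I {zero} tt)
  empty (false ∷ I) ∉I = cong (false ∷_) (empty I (λ {b} → ∉I {suc b}))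

module _ {n : ℕ} where

  PrefixIdeal : Rel (Fin n) 0ℓ → ℕ → Set
  PrefixIdeal _≼_ N = ∀ a b → toℕ b < N → a ≼ b → toℕ a < N

  prefixIdeal? : ∀ {_≼_} → Decidable _≼_ → U.Decidable (PrefixIdeal _≼_)
  prefixIdeal? _≼?_ N = all? λ a → all? λ b → toℕ b <? N →-dec (a ≼? b →-dec toℕ a <? N)

  isOrderIdeal-prefix : ∀ {_≼_ N} → IsOrderIdeal _≼_ (prefix n N) ⇔ PrefixIdeal _≼_ N
  isOrderIdeal-prefix = mk⇔
    (λ ideal a b b<N a≼b → to ∈-prefix (ideal a b (from ∈-prefix b<N) a≼b))
    (λ ideal a b b∈ a≼b → from ∈-prefix (ideal a b (to ∈-prefix b∈) a≼b))

  inPolytope⇔prefixBounds : ∀ {_≼_} → F._≤_ ⇒ _≼_ → ∀ {ℓ x} →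
    InPolytope _≼_ ℓ x ⇔ (∀ {N} → N ≤ n → PrefixIdeal _≼_ N → sumOver (prefix n N) x ≤ ℓ * N)
  inPolytope⇔prefixBounds ≤⇒≼ {ℓ} {x} = mk⇔
    (λ x∈Q {N} N≤n ideal → subst (λ m → sumOver (prefix n N) x ≤ ℓ * m) (∣prefix∣ N≤n)
                                 (x∈Q (prefix n N) (from isOrderIdeal-prefix ideal)))
    (λ bounds I ideal → case downClosed⇒prefix I (λ a≤b b∈ → ideal _ _ b∈ (≤⇒≼ a≤b)) of λ where
       (N , N≤n , refl) → subst (λ m → sumOver (prefix n N) x ≤ ℓ * m) (sym (∣prefix∣ N≤n))
                                (bounds N≤n (to isOrderIdeal-prefix ideal)))

opposite<∸⇔ : ∀ {n M} (i : Fin n) → toℕ (F.opposite i) < n ∸ M ⇔ M ≤ toℕ i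
opposite<∸⇔ {n} {M} i = mk⇔
  (λ opp<n∸M → ≮⇒≥ λ i<M → <⇒≱ (subst (_< n ∸ M) (opposite-prop i) opp<n∸M) (∸-monoʳ-≤ n i<M))
  (λ M≤i → subst (_< n ∸ M) (sym (opposite-prop i)) (∸-monoʳ-< (s≤s M≤i) (toℕ<n i)))

prefixIdeal-reverse : ∀ {n} {_≼_ : Rel (Fin n) 0ℓ} {M} → M ≤ n →
                      PrefixIdeal (flip _≼_ on F.opposite) M ⇔ PrefixIdeal _≼_ (n ∸ M)
prefixIdeal-reverse {n} {_≼_} {M} M≤n = mk⇔
  (λ ideal a b b<n∸M a≼b → case toℕ a <? n ∸ M of λ where
     (yes a<n∸M) → a<n∸M
     (no a≮n∸M)  → contradiction b<n∸M (≤⇒≯ (to opposite<M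
       (ideal (F.opposite b) (F.opposite a) (from opposite<M (≮⇒≥ a≮n∸M))
         (subst₂ _≼_ (sym (opposite-involutive a)) (sym (opposite-involutive b)) a≼b)))))
  (λ ideal a b b<M opp-b≼opp-a → case toℕ a <? M of λ where
     (yes a<M) → a<M
     (no a≮M)  → contradiction b<M (≤⇒≯ (to (opposite<∸⇔ b)
       (ideal (F.opposite b) (F.opposite a) (from (opposite<∸⇔ a) (≮⇒≥ a≮M)) opp-b≼opp-a))))
  where
  opposite<M : ∀ {i : Fin n} → toℕ (F.opposite i) < M ⇔ n ∸ M ≤ toℕ i
  opposite<M {i} = subst (λ m → toℕ (F.opposite i) < m ⇔ n ∸ M ≤ toℕ i) (m∸[m∸n]≡n M≤n) (opposite<∸⇔ i)

-- Lattice paths in a box and their conjugates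

words : ℕ → ℕ → List (List ℕ)
words A B = sequences (downFrom (suc B)) A

∈-words : ∀ {A B h} → h ∈ words A B ⇔ (length h ≡ A × All (_≤ B) h)
∈-words {A} {B} = mk⇔
  (λ h∈ → let |h|≡A , h⊆ = to (∈-sequences _ A) h∈ in |h|≡A , All.map (λ d∈ → ≤-pred (∈-downFrom⁻ d∈)) h⊆)
  (λ (|h|≡A , h≤B) → from (∈-sequences _ A) (|h|≡A , All.map (λ d≤B → ∈-downFrom⁺ (s≤s d≤B)) h≤B))

record IsCornerPath (k ℓ n : ℕ) (Adm : U.Pred ℕ 0ℓ) (h : List ℕ) : Set where
  field
    length≡ : length h ≡ k * n
    bounded : All (_≤ ℓ * n) h
    sorted  : AllPairs _≤_ h
    corners : ∀ {N} → N ≤ n → Adm N → All (_≤ ℓ * N) (take (k * N) h)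

module _ (k ℓ n : ℕ) {Adm : U.Pred ℕ 0ℓ} (Adm? : U.Decidable Adm) where

  private
    shape? : ∀ h → Dec (AllPairs _≤_ h × (∀ {N} → N ≤ n → Adm N → All (_≤ ℓ * N) (take (k * N) h)))
    shape? h = allPairs? _≤?_ h ×-dec map′ (λ below {N} N≤n → below {N} (s≤s N≤n))
                                            (λ below {N} N<1+n → below {N} (≤-pred N<1+n))
      (allUpTo? (λ N → Adm? N →-dec All.all? (_≤? ℓ * N) (take (k * N) h)) (suc n))

  cornerPaths : List (List ℕ)
  cornerPaths = filter shape? (words (k * n) (ℓ * n))

  ∈-cornerPaths : ∀ {h} → h ∈ cornerPaths ⇔ IsCornerPath k ℓ n Adm h
  ∈-cornerPaths = mk⇔
    (λ h∈ → let h∈words , sorted , corners = ∈-filter⁻ shape? {xs = words (k * n) (ℓ * n)} h∈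
                length≡ , bounded = to ∈-words h∈words
            in record { length≡ = length≡ ; bounded = bounded ; sorted = sorted ; corners = corners })
    (λ path → let open IsCornerPath path in
      ∈-filter⁺ shape? (from ∈-words (length≡ , bounded)) (sorted , corners))

  cornerPaths-unique : Unique cornerPaths
  cornerPaths-unique = Unique.filter⁺ shape? (sequences-unique _ (Unique.downFrom⁺ (suc (ℓ * n))) (k * n))

countAbove : ℕ → List ℕ → ℕ
countAbove t h = length (filter (t <?_) h)

conjugate : ℕ → List ℕ → List ℕ
conjugate B h = map (λ t → countAbove t h) (downFrom B)

countAbove-all : ∀ {t h} → All (t <_) h → countAbove t h ≡ length h
countAbove-all {t} t<h = cong length (filter-all (t <?_) t<h)

countAbove-antitone : ∀ {t t′} → t ≤ t′ → ∀ h → countAbove t′ h ≤ countAbove t h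
countAbove-antitone {t} {t′} t≤t′ h =
  length-mono-≤ (Sublist.filter⁺ (t′ <?_) (t <?_) (λ { refl t′<x → ≤-<-trans t≤t′ t′<x }) (⊆-refl {x = h}))

countAbove-take : ∀ {i j} h → All (_≤ j) (take i h) → countAbove j h ≤ length h ∸ i
countAbove-take {i} {j} h h≤j = begin
  countAbove j h
    ≡⟨ cong (countAbove j) (take++drop≡id i h) ⟨
  length (filter (j <?_) (take i h ++ drop i h))
    ≡⟨ cong length (filter-++ (j <?_) (take i h) (drop i h)) ⟩
  length (filter (j <?_) (take i h) ++ filter (j <?_) (drop i h))
    ≡⟨ cong (λ xs → length (xs ++ filter (j <?_) (drop i h))) (filter-none (j <?_) (All.map ≤⇒≯ h≤j)) ⟩
  length (filter (j <?_) (drop i h))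
    ≤⟨ length-filter (j <?_) (drop i h) ⟩
  length (drop i h)
    ≡⟨ length-drop i h ⟩
  length h ∸ i ∎
  where open ≤-Reasoning

countBelow-downFrom : ∀ {x B} → x ≤ B → length (filter (_<? x) (downFrom B)) ≡ x
countBelow-downFrom {zero}  {zero}  z≤n = refl
countBelow-downFrom {x}     {suc B} x≤1+B with B <? x
... | yes B<x = begin
  length (filter (_<? x) (B ∷ downFrom B))  ≡⟨ cong length (filter-accept (_<? x) B<x) ⟩
  suc (length (filter (_<? x) (downFrom B))) ≡⟨ cong (suc ∘ length) (filter-all (_<? x) below-x) ⟩
  suc (length (downFrom B))                  ≡⟨ cong suc (length-downFrom B) ⟩
  suc B                                      ≡⟨ ≤-antisym B<x x≤1+B ⟩
  x                                          ∎
  where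
  open ≡-Reasoning
  below-x : All (_< x) (downFrom B)
  below-x = All.tabulate λ t∈ → <-trans (∈-downFrom⁻ t∈) B<x
... | no B≮x  = trans (cong length (filter-reject (_<? x) B≮x)) (countBelow-downFrom (≮⇒≥ B≮x))

take-downFrom : ∀ m B → All (B ∸ m ≤_) (take m (downFrom B))
take-downFrom zero    B       = []
take-downFrom (suc m) zero    = []
take-downFrom (suc m) (suc B) = m∸n≤m B m ∷ take-downFrom m B

module _ (B : ℕ) (h : List ℕ) where

  length-conjugate : length (conjugate B h) ≡ B
  length-conjugate = trans (length-map _ (downFrom B)) (length-downFrom B)

  conjugate-bounded : All (_≤ length h) (conjugate B h)
  conjugate-bounded = All.map⁺ (All.tabulate λ {t} _ → length-filter (t <?_) h)

  conjugate-sorted : AllPairs _≤_ (conjugate B h)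
  conjugate-sorted = AllPairs.map⁺ (AllPairs.map (λ t≤s → countAbove-antitone t≤s h) (descending B))
    where
    descending : ∀ B → AllPairs (λ s t → t ≤ s) (downFrom B)
    descending zero    = []
    descending (suc B) = All.tabulate (λ t∈ → <⇒≤ (∈-downFrom⁻ t∈)) ∷ descending B

  countAbove-conjugate : ∀ s →
    countAbove s (conjugate B h) ≡ length (filter (λ t → s <? countAbove t h) (downFrom B))
  countAbove-conjugate s = length-filter-map (s <?_) (λ t → countAbove t h) (downFrom B)

  conjugate-take : ∀ {i j} → j ≤ B → All (_≤ j) (take i h) →
                   All (_≤ length h ∸ i) (take (B ∸ j) (conjugate B h))
  conjugate-take {i} {j} j≤B h≤j = subst (All (_≤ length h ∸ i)) (sym (take-map (B ∸ j) (downFrom B)))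
    (All.map⁺ (All.map (λ j≤t → ≤-trans (countAbove-antitone j≤t h) (countAbove-take h h≤j)) j≤prefix))
    where
    j≤prefix : All (j ≤_) (take (B ∸ j) (downFrom B))
    j≤prefix = subst (λ m → All (m ≤_) (take (B ∸ j) (downFrom B))) (m∸[m∸n]≡n j≤B) (take-downFrom (B ∸ j) B)

countAbove-cons-≮ : ∀ {t x} h → ¬ t < x → countAbove t (x ∷ h) ≡ countAbove t h
countAbove-cons-≮ {t} h t≮x = cong length (filter-reject (t <?_) t≮x)

module _ {x : ℕ} {h : List ℕ} (x≤h : All (x ≤_) h) where

  countAbove-cons-< : ∀ {t} → t < x → countAbove t (x ∷ h) ≡ suc (length h)
  countAbove-cons-< t<x = countAbove-all (t<x ∷ All.map (<-≤-trans t<x) x≤h)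

  countAbove-conjugate-∷-top : ∀ {B} → x ≤ B → countAbove (length h) (conjugate B (x ∷ h)) ≡ x
  countAbove-conjugate-∷-top {B} x≤B = begin
    countAbove (length h) (conjugate B (x ∷ h))
      ≡⟨ countAbove-conjugate B (x ∷ h) (length h) ⟩
    length (filter (λ t → length h <? countAbove t (x ∷ h)) (downFrom B))
      ≡⟨ cong length (filter-≐ _ (_<? x) (full⇒below , below⇒full) (downFrom B)) ⟩
    length (filter (_<? x) (downFrom B))
      ≡⟨ countBelow-downFrom x≤B ⟩
    x ∎
    where
    open ≡-Reasoning
    full⇒below : ∀ {t} → length h < countAbove t (x ∷ h) → t < x
    full⇒below {t} full with t <? x
    ... | yes t<x = t<x
    ... | no t≮x  =
      contradiction (length-filter (t <?_) h) (<⇒≱ (subst (length h <_) (countAbove-cons-≮ h t≮x) full))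
    below⇒full : ∀ {t} → t < x → length h < countAbove t (x ∷ h)
    below⇒full t<x = subst (length h <_) (sym (countAbove-cons-< t<x)) (n<1+n (length h))

  countAbove-conjugate-∷ : ∀ {B s} → s < length h →
                           countAbove s (conjugate B (x ∷ h)) ≡ countAbove s (conjugate B h)
  countAbove-conjugate-∷ {B} {s} s<|h| = begin
    countAbove s (conjugate B (x ∷ h))
      ≡⟨ countAbove-conjugate B (x ∷ h) s ⟩
    length (filter (λ t → s <? countAbove t (x ∷ h)) (downFrom B))
      ≡⟨ cong length (filter-≐ _ _ (into , onto) (downFrom B)) ⟩
    length (filter (λ t → s <? countAbove t h) (downFrom B))
      ≡⟨ countAbove-conjugate B h s ⟨
    countAbove s (conjugate B h) ∎
    where
    open ≡-Reasoning
    into : ∀ {t} → s < countAbove t (x ∷ h) → s < countAbove t h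
    into {t} s< with t <? x
    ... | yes t<x = subst (s <_) (sym (countAbove-all (All.map (<-≤-trans t<x) x≤h))) s<|h|
    ... | no t≮x  = subst (s <_) (countAbove-cons-≮ h t≮x) s<
    onto : ∀ {t} → s < countAbove t h → s < countAbove t (x ∷ h)
    onto {t} s< with t <? x
    ... | yes t<x = subst (s <_) (sym (countAbove-cons-< t<x)) (m<n⇒m<1+n s<|h|)
    ... | no t≮x  = subst (s <_) (sym (countAbove-cons-≮ h t≮x)) s<

conjugate-involutive : ∀ B h → AllPairs _≤_ h → All (_≤ B) h → conjugate (length h) (conjugate B h) ≡ h
conjugate-involutive B []      _                _           = refl
conjugate-involutive B (x ∷ h) (x≤h ∷ h-sorted) (x≤B ∷ h≤B) = cong₂ _∷_
  (countAbove-conjugate-∷-top x≤h x≤B)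
  (trans (map-cong-local (All.tabulate λ s∈ → countAbove-conjugate-∷ x≤h {B} (∈-downFrom⁻ s∈)))
         (conjugate-involutive B h h-sorted h≤B))

m*n∸m*[n∸o]≡m*o : ∀ k {n M} → M ≤ n → k * n ∸ k * (n ∸ M) ≡ k * M
m*n∸m*[n∸o]≡m*o k {n} {M} M≤n = trans (sym (*-distribˡ-∸ k n (n ∸ M))) (cong (k *_) (m∸[m∸n]≡n M≤n))

isCornerPath-conjugate : ∀ {k ℓ n} {Adm Adm′ : U.Pred ℕ 0ℓ} → (∀ {M} → M ≤ n → Adm′ M → Adm (n ∸ M)) →
                         ∀ {h} → IsCornerPath k ℓ n Adm h → IsCornerPath ℓ k n Adm′ (conjugate (ℓ * n) h)
isCornerPath-conjugate {k} {ℓ} {n} Adm′⇒Adm {h} path = record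
  { length≡ = length-conjugate (ℓ * n) h
  ; bounded = subst (λ m → All (_≤ m) (conjugate (ℓ * n) h)) length≡ (conjugate-bounded (ℓ * n) h)
  ; sorted  = conjugate-sorted (ℓ * n) h
  ; corners = λ {M} M≤n adm′ →
      subst₂ (λ b m → All (_≤ b) (take m (conjugate (ℓ * n) h)))
        (trans (cong (_∸ k * (n ∸ M)) length≡) (m*n∸m*[n∸o]≡m*o k M≤n)) (m*n∸m*[n∸o]≡m*o ℓ M≤n)
        (conjugate-take (ℓ * n) h (*-monoʳ-≤ ℓ (m∸n≤m n M)) (corners (m∸n≤m n M) (Adm′⇒Adm M≤n adm′)))
  }
  where open IsCornerPath path

cornerPaths-transpose : ∀ k ℓ n {Adm Adm′ : U.Pred ℕ 0ℓ} (Adm? : U.Decidable Adm) (Adm′? : U.Decidable Adm′) →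
                        (∀ {M} → M ≤ n → Adm′ M ⇔ Adm (n ∸ M)) →
                        length (cornerPaths k ℓ n Adm?) ≡ length (cornerPaths ℓ k n Adm′?)
cornerPaths-transpose k ℓ n {Adm} {Adm′} Adm? Adm′? Adm′⇔Adm =
  length-≡-by-inverses (cornerPaths-unique k ℓ n Adm?) (cornerPaths-unique ℓ k n Adm′?)
    (conjugate (ℓ * n)) (conjugate (k * n))
    (λ h∈ → let path = to (∈-cornerPaths k ℓ n Adm?) h∈ in
      from (∈-cornerPaths ℓ k n Adm′?) (isCornerPath-conjugate (to ∘ Adm′⇔Adm) path) , involutive path)
    (λ h∈ → let path = to (∈-cornerPaths ℓ k n Adm′?) h∈ in
      from (∈-cornerPaths k ℓ n Adm?) (isCornerPath-conjugate Adm⇒Adm′ path) , involutive path)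
  where
  involutive : ∀ {k ℓ Adm h} → IsCornerPath k ℓ n Adm h → conjugate (k * n) (conjugate (ℓ * n) h) ≡ h
  involutive {k} {ℓ} {h = h} path = subst (λ m → conjugate m (conjugate (ℓ * n) h) ≡ h) length≡
                                          (conjugate-involutive (ℓ * n) h sorted bounded)
    where open IsCornerPath path
  Adm⇒Adm′ : ∀ {N} → N ≤ n → Adm N → Adm′ (n ∸ N)
  Adm⇒Adm′ {N} N≤n adm = from (Adm′⇔Adm (m∸n≤m n N)) (subst Adm (sym (m∸[m∸n]≡n N≤n)) adm)

-- Encoding multichains as lattice paths

heads : ∀ {n} → List (Vec ℕ (suc n)) → List ℕ
heads = map V.head

tails : ∀ {n} → List (Vec ℕ (suc n)) → List (Vec ℕ n)
tails = map V.tail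

-- Block j of k letters lists the j-th coordinates of p₁, …, p_k raised by the sum of the first j
-- coordinates of p_k.
encode : ∀ {n} → List (Vec ℕ n) → List ℕ
encode {zero}  ps = []
encode {suc n} ps = heads ps ++ map (lastOr 0 (heads ps) +_) (encode (tails ps))

decode : ∀ n → ℕ → List ℕ → List (Vec ℕ n)
decode zero    k h = replicate k []
decode (suc n) k h = zipWith _∷_ (take k h) (decode n k (map (_∸ lastOr 0 (take k h)) (drop k h)))

lastPoint : ∀ {n} → List (Vec ℕ n) → Vec ℕ n
lastPoint = lastOr (V.replicate _ 0)

length-encode : ∀ {n k} (ps : List (Vec ℕ n)) → length ps ≡ k → length (encode ps) ≡ k * n
length-encode {zero}  {k} ps _      = sym (*-zeroʳ k)
length-encode {suc n} {k} ps |ps|≡k = begin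
  length (heads ps ++ map _ (encode (tails ps)))          ≡⟨ length-++ (heads ps) ⟩
  length (heads ps) + length (map _ (encode (tails ps)))  ≡⟨ cong₂ _+_ |heads|≡k |shifted|≡kn ⟩
  k + k * n                                               ≡⟨ *-suc k n ⟨
  k * suc n                                               ∎
  where
  open ≡-Reasoning
  |heads|≡k : length (heads ps) ≡ k
  |heads|≡k = trans (length-map _ ps) |ps|≡k
  |shifted|≡kn : length (map (lastOr 0 (heads ps) +_) (encode (tails ps))) ≡ k * n
  |shifted|≡kn =
    trans (length-map _ (encode (tails ps))) (length-encode (tails ps) (trans (length-map _ ps) |ps|≡k))

length-decode : ∀ n k h → length h ≡ k * n → length (decode n k h) ≡ k
length-decode zero    k h _      = length-replicate k
length-decode (suc n) k h |h|≡kn = begin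
  length (zipWith _∷_ (take k h) rest)   ≡⟨ length-zipWith _∷_ (take k h) rest ⟩
  length (take k h) ⊓ length rest        ≡⟨ cong₂ _⊓_ |take|≡k |rest|≡k ⟩
  k ⊓ k                                  ≡⟨ ⊓-idem k ⟩
  k                                      ∎
  where
  open ≡-Reasoning
  rest = decode n k (map (_∸ lastOr 0 (take k h)) (drop k h))
  |take|≡k : length (take k h) ≡ k
  |take|≡k = proj₁ (length-take-drop k n h |h|≡kn)
  |rest|≡k : length rest ≡ k
  |rest|≡k = length-decode n k _ (trans (length-map _ (drop k h)) (proj₂ (length-take-drop k n h |h|≡kn)))

module _ {n : ℕ} where

  zipWith-heads-tails : ∀ (ps : List (Vec ℕ (suc n))) → zipWith _∷_ (heads ps) (tails ps) ≡ ps
  zipWith-heads-tails []             = refl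
  zipWith-heads-tails ((x ∷ v) ∷ ps) = cong ((x ∷ v) ∷_) (zipWith-heads-tails ps)

  heads-zipWith : ∀ xs (vs : List (Vec ℕ n)) → length xs ≡ length vs → heads (zipWith _∷_ xs vs) ≡ xs
  heads-zipWith []       []       _     = refl
  heads-zipWith (x ∷ xs) (v ∷ vs) |xs|≡ = cong (x ∷_) (heads-zipWith xs vs (suc-injective |xs|≡))

  tails-zipWith : ∀ xs (vs : List (Vec ℕ n)) → length xs ≡ length vs → tails (zipWith _∷_ xs vs) ≡ vs
  tails-zipWith []       []       _     = refl
  tails-zipWith (x ∷ xs) (v ∷ vs) |xs|≡ = cong (v ∷_) (tails-zipWith xs vs (suc-injective |xs|≡))

decode-encode : ∀ {n k} (ps : List (Vec ℕ n)) → length ps ≡ k → decode n k (encode ps) ≡ ps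
decode-encode {zero}      ps |ps|≡k = nils ps |ps|≡k
  where
  nils : ∀ {k} (ps : List (Vec ℕ 0)) → length ps ≡ k → replicate k [] ≡ ps
  nils []        refl = refl
  nils ([] ∷ ps) refl = cong ([] ∷_) (nils ps refl)
decode-encode {suc n} {k} ps |ps|≡k = begin
  decode (suc n) k (hs ++ shifted)
    ≡⟨ cong₂ (λ a b → zipWith _∷_ a (decode n k (map (_∸ lastOr 0 a) b))) take≡hs drop≡shifted ⟩
  zipWith _∷_ hs (decode n k (map (_∸ y) (map (y +_) (encode (tails ps)))))
    ≡⟨ cong (λ t → zipWith _∷_ hs (decode n k t)) unshift ⟩
  zipWith _∷_ hs (decode n k (encode (tails ps)))
    ≡⟨ cong (zipWith _∷_ hs) (decode-encode (tails ps) (trans (length-map _ ps) |ps|≡k)) ⟩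
  zipWith _∷_ hs (tails ps)
    ≡⟨ zipWith-heads-tails ps ⟩
  ps ∎
  where
  open ≡-Reasoning
  hs = heads ps
  y = lastOr 0 hs
  shifted = map (y +_) (encode (tails ps))
  |hs|≡k : length hs ≡ k
  |hs|≡k = trans (length-map _ ps) |ps|≡k
  take≡hs : take k (hs ++ shifted) ≡ hs
  take≡hs = subst (λ m → take m (hs ++ shifted) ≡ hs) |hs|≡k (take-length-++ hs shifted)
  drop≡shifted : drop k (hs ++ shifted) ≡ shifted
  drop≡shifted = subst (λ m → drop m (hs ++ shifted) ≡ shifted) |hs|≡k (drop-length-++ hs shifted)
  unshift : map (_∸ y) (map (y +_) (encode (tails ps))) ≡ encode (tails ps)
  unshift = trans (sym (map-∘ _)) (map-id-local (All.tabulate λ {x} _ → m+n∸m≡n y x))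

encode-decode : ∀ n k h → length h ≡ k * n → AllPairs _≤_ h → encode (decode n k h) ≡ h
encode-decode zero    k []      _           _      = refl
encode-decode zero    k (_ ∷ _) |h|≡k*0     _      with () ← trans |h|≡k*0 (*-zeroʳ k)
encode-decode (suc n) k h       |h|≡k[1+n] sorted = begin
  encode (zipWith _∷_ a Z)
    ≡⟨ cong₂ (λ hs ts → hs ++ map (lastOr 0 hs +_) (encode ts))
             (heads-zipWith a Z |a|≡|Z|) (tails-zipWith a Z |a|≡|Z|) ⟩
  a ++ map (c +_) (encode Z)
    ≡⟨ cong (λ t → a ++ map (c +_) t) (encode-decode n k _ |lowered|≡kn lowered-sorted) ⟩
  a ++ map (c +_) (map (_∸ c) rest)
    ≡⟨ cong (a ++_) reshift ⟩
  a ++ rest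
    ≡⟨ take++drop≡id k h ⟩
  h ∎
  where
  open ≡-Reasoning
  a = take k h
  rest = drop k h
  c = lastOr 0 a
  Z = decode n k (map (_∸ c) rest)
  split : AllPairs _≤_ a × AllPairs _≤_ rest × All (λ x → All (x ≤_) rest) a
  split = AllPairs-++⁻ a (subst (AllPairs _≤_) (sym (take++drop≡id k h)) sorted)
  |lowered|≡kn : length (map (_∸ c) rest) ≡ k * n
  |lowered|≡kn = trans (length-map _ rest) (proj₂ (length-take-drop k n h |h|≡k[1+n]))
  |a|≡|Z| : length a ≡ length Z
  |a|≡|Z| = trans (proj₁ (length-take-drop k n h |h|≡k[1+n])) (sym (length-decode n k _ |lowered|≡kn))
  lowered-sorted : AllPairs _≤_ (map (_∸ c) rest)
  lowered-sorted = AllPairs.map⁺ (AllPairs.map (∸-monoˡ-≤ c) (proj₁ (proj₂ split)))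
  reshift : map (c +_) (map (_∸ c) rest) ≡ rest
  reshift = trans (sym (map-∘ rest))
                  (map-id-local (All.map m+[n∸m]≡n (lastOr-All (All.tabulate λ _ → z≤n) (proj₂ (proj₂ split)))))

module _ {n : ℕ} where

  ≤ᵥ-head : ∀ {u v : Vec ℕ (suc n)} → u ≤ᵥ v → V.head u ≤ V.head v
  ≤ᵥ-head (x≤y ∷ _) = x≤y

  ≤ᵥ-tail : ∀ {u v : Vec ℕ (suc n)} → u ≤ᵥ v → V.tail u ≤ᵥ V.tail v
  ≤ᵥ-tail (_ ∷ u≤v) = u≤v

  ≤ᵥ-cons : ∀ {u v : Vec ℕ (suc n)} → V.head u ≤ V.head v → V.tail u ≤ᵥ V.tail v → u ≤ᵥ v
  ≤ᵥ-cons {_ ∷ _} {_ ∷ _} x≤y u≤v = x≤y ∷ u≤v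

chain⇔sorted-encode : ∀ {n} {ps : List (Vec ℕ n)} → AllPairs _≤ᵥ_ ps ⇔ AllPairs _≤_ (encode ps)
chain⇔sorted-encode = mk⇔ into onto
  where
  into : ∀ {n} {ps : List (Vec ℕ n)} → AllPairs _≤ᵥ_ ps → AllPairs _≤_ (encode ps)
  into {zero}      _     = []
  into {suc n} {ps} chain =
    AllPairs.++⁺ heads-sorted (AllPairs.map⁺ (AllPairs.map (+-monoʳ-≤ y) (into tails-chain)))
      (All.map (λ x≤y → All.map⁺ (All.tabulate λ {t} _ → ≤-trans x≤y (m≤m+n y t)))
               (≼-lastOr ≤-refl heads-sorted))
    where
    y = lastOr 0 (heads ps)
    heads-sorted : AllPairs _≤_ (heads ps)
    heads-sorted = AllPairs.map⁺ (AllPairs.map ≤ᵥ-head chain)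
    tails-chain : AllPairs _≤ᵥ_ (tails ps)
    tails-chain = AllPairs.map⁺ (AllPairs.map ≤ᵥ-tail chain)
  onto : ∀ {n} {ps : List (Vec ℕ n)} → AllPairs _≤_ (encode ps) → AllPairs _≤ᵥ_ ps
  onto {zero}  {ps} _      = trivial ps
    where
    trivial : ∀ (ps : List (Vec ℕ 0)) → AllPairs _≤ᵥ_ ps
    trivial []       = []
    trivial (p ∷ ps) = All.tabulate (λ { {[]} _ → ≤ᵥ-nil p }) ∷ trivial ps
      where
      ≤ᵥ-nil : ∀ (u : Vec ℕ 0) → u ≤ᵥ []
      ≤ᵥ-nil [] = []
  onto {suc n} {ps} sorted =
    AllPairs.zipWith (λ (x≤y , u≤v) → ≤ᵥ-cons x≤y u≤v)
                     (AllPairs.map⁻ heads-sorted , AllPairs.map⁻ (onto tails-sorted))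
    where
    y = lastOr 0 (heads ps)
    split : AllPairs _≤_ (heads ps) × AllPairs _≤_ (map (y +_) (encode (tails ps))) ×
            All (λ x → All (x ≤_) (map (y +_) (encode (tails ps)))) (heads ps)
    split = AllPairs-++⁻ (heads ps) sorted
    heads-sorted : AllPairs _≤_ (heads ps)
    heads-sorted = proj₁ split
    tails-sorted : AllPairs _≤_ (encode (tails ps))
    tails-sorted = AllPairs.map (λ {a} {b} → +-cancelˡ-≤ y a b) (AllPairs.map⁻ (proj₁ (proj₂ split)))

sumOver-prefix-0 : ∀ {n} (x : Vec ℕ n) → sumOver (prefix n 0) x ≡ 0
sumOver-prefix-0 []       = refl
sumOver-prefix-0 (_ ∷ xs) = sumOver-prefix-0 xs

sumOver-replicate-0 : ∀ {n} (I : Subset n) → sumOver I (V.replicate n 0) ≡ 0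
sumOver-replicate-0 []          = refl
sumOver-replicate-0 (true ∷ I)  = sumOver-replicate-0 I
sumOver-replicate-0 (false ∷ I) = sumOver-replicate-0 I

sumOver-mono : ∀ {n} (I : Subset n) {u v : Vec ℕ n} → u ≤ᵥ v → sumOver I u ≤ sumOver I v
sumOver-mono []          []            = z≤n
sumOver-mono (true ∷ I)  (x≤y ∷ u≤v) = +-mono-≤ x≤y (sumOver-mono I u≤v)
sumOver-mono (false ∷ I) (_   ∷ u≤v) = sumOver-mono I u≤v

lastOr-take-encode : ∀ {n k N} (ps : List (Vec ℕ n)) → length ps ≡ k → N ≤ n →
                     lastOr 0 (take (k * N) (encode ps)) ≡ sumOver (prefix n N) (lastPoint ps)
lastOr-take-encode {n}     {k} {zero}  ps _ _ = begin
  lastOr 0 (take (k * 0) (encode ps))  ≡⟨ cong (λ m → lastOr 0 (take m (encode ps))) (*-zeroʳ k) ⟩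
  0                                    ≡⟨ sumOver-prefix-0 (lastPoint ps) ⟨
  sumOver (prefix n 0) (lastPoint ps)  ∎
  where open ≡-Reasoning
lastOr-take-encode {suc n} {k} {suc N} ps |ps|≡k (s≤s N≤n) = begin
  lastOr 0 (take (k * suc N) (hs ++ shifted))
    ≡⟨ cong (λ m → lastOr 0 (take m (hs ++ shifted))) k[1+N]≡ ⟩
  lastOr 0 (take (length hs + k * N) (hs ++ shifted))
    ≡⟨ cong (lastOr 0) (take-++ hs shifted (k * N)) ⟩
  lastOr 0 (hs ++ take (k * N) shifted)
    ≡⟨ lastOr-++ 0 hs _ ⟩
  lastOr y (take (k * N) shifted)
    ≡⟨ cong (lastOr y) (take-map (k * N) (encode (tails ps))) ⟩
  lastOr y (map (y +_) (take (k * N) (encode (tails ps))))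
    ≡⟨ lastOr-shift y (take (k * N) (encode (tails ps))) ⟩
  y + lastOr 0 (take (k * N) (encode (tails ps)))
    ≡⟨ cong₂ _+_ (lastOr-map V.head _ ps) (lastOr-take-encode (tails ps) (trans (length-map _ ps) |ps|≡k) N≤n) ⟩
  V.head (lastPoint ps) + sumOver (prefix n N) (lastPoint (tails ps))
    ≡⟨ cong (λ v → V.head (lastPoint ps) + sumOver (prefix n N) v) (lastOr-map V.tail _ ps) ⟩
  V.head (lastPoint ps) + sumOver (prefix n N) (V.tail (lastPoint ps))
    ≡⟨ sumOver-prefix-suc (lastPoint ps) ⟨
  sumOver (prefix (suc n) (suc N)) (lastPoint ps) ∎
  where
  open ≡-Reasoning
  hs = heads ps
  y = lastOr 0 hs
  shifted = map (y +_) (encode (tails ps))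
  k[1+N]≡ : k * suc N ≡ length hs + k * N
  k[1+N]≡ = trans (*-suc k N) (cong (_+ k * N) (sym (trans (length-map _ ps) |ps|≡k)))
  sumOver-prefix-suc : ∀ (x : Vec ℕ (suc n)) →
                       sumOver (prefix (suc n) (suc N)) x ≡ V.head x + sumOver (prefix n N) (V.tail x)
  sumOver-prefix-suc (_ ∷ _) = refl

module _ {n : ℕ} {_≼_ : Rel (Fin n) 0ℓ} (≤⇒≼ : F._≤_ ⇒ _≼_) {k ℓ : ℕ} where

  isCornerPath-encode : ∀ {ps} → IsMultichain _≼_ k ℓ ps → IsCornerPath k ℓ n (PrefixIdeal _≼_) (encode ps)
  isCornerPath-encode {ps} mc = record
    { length≡ = length-encode ps length≡
    ; bounded = subst (All (_≤ ℓ * n)) (take-all (k * n) (encode ps) (≤-reflexive (length-encode ps length≡)))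
                      (corners ≤-refl (λ a _ _ _ → toℕ<n a))
    ; sorted  = sorted
    ; corners = corners
    }
    where
    open IsMultichain mc
    sorted : AllPairs _≤_ (encode ps)
    sorted = to chain⇔sorted-encode chain
    origin-inPolytope : InPolytope _≼_ ℓ (V.replicate n 0)
    origin-inPolytope I _ = subst (_≤ ℓ * ∣ I ∣) (sym (sumOver-replicate-0 I)) z≤n
    corners : ∀ {N} → N ≤ n → PrefixIdeal _≼_ N → All (_≤ ℓ * N) (take (k * N) (encode ps))
    corners {N} N≤n ideal = sorted-≤-lastOr (AllPairs.take⁺ (k * N) sorted)
      (subst (_≤ ℓ * N) (sym (lastOr-take-encode ps length≡ N≤n))
        (to (inPolytope⇔prefixBounds ≤⇒≼ {ℓ}) (lastOr-All origin-inPolytope inPolytope) N≤n ideal))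

  decode-isMultichain : ∀ {h} → IsCornerPath k ℓ n (PrefixIdeal _≼_) h → IsMultichain _≼_ k ℓ (decode n k h)
  decode-isMultichain {h} path = record
    { length≡    = |ps|≡k
    ; chain      = chain
    ; inPolytope = All.map (λ p≤last → from (inPolytope⇔prefixBounds ≤⇒≼ {ℓ}) (bounds p≤last))
                           (≼-lastOr (Pointwise.refl ≤-refl) {d = V.replicate n 0} chain)
    }
    where
    open IsCornerPath path
    ps = decode n k h
    |ps|≡k : length ps ≡ k
    |ps|≡k = length-decode n k h length≡
    encode≡h : encode ps ≡ h
    encode≡h = encode-decode n k h length≡ sorted
    chain : AllPairs _≤ᵥ_ ps
    chain = from chain⇔sorted-encode (subst (AllPairs _≤_) (sym encode≡h) sorted)
    bounds : ∀ {p} → p ≤ᵥ lastPoint ps → ∀ {N} → N ≤ n → PrefixIdeal _≼_ N → sumOver (prefix n N) p ≤ ℓ * N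
    bounds {p} p≤last {N} N≤n ideal = begin
      sumOver (prefix n N) p               ≤⟨ sumOver-mono (prefix n N) p≤last ⟩
      sumOver (prefix n N) (lastPoint ps)  ≡⟨ lastOr-take-encode ps |ps|≡k N≤n ⟨
      lastOr 0 (take (k * N) (encode ps))  ≡⟨ cong (λ w → lastOr 0 (take (k * N) w)) encode≡h ⟩
      lastOr 0 (take (k * N) h)            ≤⟨ lastOr-All z≤n (corners N≤n ideal) ⟩
      ℓ * N                                ∎
      where open ≤-Reasoning

∇-cornerPaths : ∀ {n} {_≼_ : Rel (Fin n) 0ℓ} (_≼?_ : Decidable _≼_) → F._≤_ ⇒ _≼_ → ∀ k ℓ →
                ∇ _≼?_ k ℓ ≡ length (cornerPaths k ℓ n (prefixIdeal? _≼?_))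
∇-cornerPaths {n} {_≼_} _≼?_ ≤⇒≼ k ℓ =
  length-≡-by-inverses (multichains-unique _≼?_ k ℓ) (cornerPaths-unique k ℓ n (prefixIdeal? _≼?_))
    encode (decode n k)
    (λ ps∈ → let mc = to (∈-multichains _≼?_ k ℓ) ps∈ in
      from ∈-paths (isCornerPath-encode ≤⇒≼ mc) , decode-encode _ (IsMultichain.length≡ mc))
    (λ h∈ → let path = to ∈-paths h∈ in
      from (∈-multichains _≼?_ k ℓ) (decode-isMultichain ≤⇒≼ path) ,
      encode-decode n k _ (IsCornerPath.length≡ path) (IsCornerPath.sorted path))
  where
  ∈-paths : ∀ {h} → h ∈ cornerPaths k ℓ n (prefixIdeal? _≼?_) ⇔ IsCornerPath k ℓ n (PrefixIdeal _≼_) h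
  ∈-paths = ∈-cornerPaths k ℓ n (prefixIdeal? _≼?_)

proposition4p3 : (n : ℕ) (_≼_ : Rel (Fin n) 0ℓ)
    → IsPreorder _≡_ _≼_ → Total _≼_
    → (_≼?_ : Decidable _≼_)
    → (k ℓ : ℕ)
    → ∇ {n} {_≼_} _≼?_ k ℓ ≡ ∇ {n} {dual _≼_} (λ a b → b ≼? a) ℓ k
proposition4p3 n _≼_ isPreorder total _≼?_ k ℓ = begin
  ∇ _≼?_ k ℓ                              ≡⟨ ∇-relabel _≼?_ σ k ℓ ⟩
  ∇ _≼σ?_ k ℓ                             ≡⟨ ∇-cornerPaths _≼σ?_ σ-sorts k ℓ ⟩
  length (cornerPaths k ℓ n σ-ideal?)     ≡⟨ cornerPaths-transpose k ℓ n σ-ideal? ρ-ideal? prefixIdeal-reverse ⟩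
  length (cornerPaths ℓ k n ρ-ideal?)     ≡⟨ ∇-cornerPaths _≽ρ?_ ρ-sorts ℓ k ⟨
  ∇ _≽ρ?_ ℓ k                             ≡⟨ ∇-relabel (λ a b → b ≼? a) ρ ℓ k ⟨
  ∇ (λ a b → b ≼? a) ℓ k                  ∎
  where
  open ≡-Reasoning
  σ : Permutation′ n
  σ = proj₁ (sorting-permutation (IsPreorder.trans isPreorder) total)
  σ-sorts : F._≤_ ⇒ (_≼_ on (σ ⟨$⟩ʳ_))
  σ-sorts = proj₂ (sorting-permutation (IsPreorder.trans isPreorder) total)
  ρ : Permutation′ n
  ρ = Perm.reverse ∘ₚ σ  -- ρ i = σ (opposite i)
  _≼σ?_ : Decidable (_≼_ on (σ ⟨$⟩ʳ_))
  a ≼σ? b = (σ ⟨$⟩ʳ a) ≼? (σ ⟨$⟩ʳ b)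
  _≽ρ?_ : Decidable (dual _≼_ on (ρ ⟨$⟩ʳ_))
  a ≽ρ? b = (ρ ⟨$⟩ʳ b) ≼? (ρ ⟨$⟩ʳ a)
  ρ-sorts : F._≤_ ⇒ (dual _≼_ on (ρ ⟨$⟩ʳ_))
  ρ-sorts {a} {b} a≤b =
    σ-sorts (subst₂ _≤_ (sym (opposite-prop b)) (sym (opposite-prop a)) (∸-monoʳ-≤ n (s≤s a≤b)))
  σ-ideal? : U.Decidable (PrefixIdeal (_≼_ on (σ ⟨$⟩ʳ_)))
  σ-ideal? = prefixIdeal? _≼σ?_
  ρ-ideal? : U.Decidable (PrefixIdeal (dual _≼_ on (ρ ⟨$⟩ʳ_)))
  ρ-ideal? = prefixIdeal? _≽ρ?_
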